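{- For each $n\in\mathbb{N}$, the curve $C_n$ is self-avoiding.
   Context: Let $e=(1,0)$, $f=(0,1)$. Let $\Omega$ be the free monoid on $u,\bar u,v,\bar v,w,\bar w$ and $\varphi$ the endomorphism with $\varphi(u)=uv$, $\varphi(\bar u)=\bar u\bar v$, $\varphi(v)=uw$, $\varphi(\bar v)=\bar u\bar w$, $\varphi(w)=\bar u w$, $\varphi(\bar w)=u\bar w$. For $n\in\mathbb{N}$ write $\varphi^n(u)=x_1\cdots x_{2^n}$ with letters $x_i$; $C_n=(S_1,\dots,S_{2^n})$ is the curve of consecutive oriented unit segments starting at $0$ in which $S_i$ is a translate of $e,-e,f,-f,f,-f$ according as $x_i=u,\bar u,v,\bar v,w,\bar w$. A curve is self-avoiding if no segment occurs twice in it (its segments are pairwise distinct). -}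

module Defs where

open import Data.Nat using (ℕ; zero; suc)
open import Data.Integer using (ℤ; +_; -_; _+_)
open import Data.Product using (_×_; _,_)
open import Data.List using (List; []; _∷_; _++_; concatMap)
open import Data.List.Relation.Unary.Unique.Propositional using (Unique)

data Letter : Set where
  u ū v v̄ w w̄ : Letter

Word : Set
Word = List Letter

φL : Letter → Word
φL u = u ∷ v ∷ []
φL ū = ū ∷ v̄ ∷ []
φL v = u ∷ w ∷ []
φL v̄ = ū ∷ w̄ ∷ []
φL w = ū ∷ w ∷ []
φL w̄ = u ∷ w̄ ∷ []

φ : Word → Word
φ = concatMap φL

φ^ : ℕ → Word → Word
φ^ zero x = x
φ^ (suc n) x = φ (φ^ n x)

Point : Set
Point = ℤ × ℤ

_⊕_ : Point → Point → Point
(a , b) ⊕ (c , d) = (a + c , b + d)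

e f : Point
e = (+ 1 , + 0)
f = (+ 0 , + 1)

neg : Point → Point
neg (a , b) = (- a , - b)

dir : Letter → Point
dir u = e
dir ū = neg e
dir v = f
dir v̄ = neg f
dir w = f
dir w̄ = neg f

-- an oriented unit segment: its starting point and its direction vector
Segment : Set
Segment = Point × Point

curveFrom : Point → Word → List Segment
curveFrom p [] = []
curveFrom p (x ∷ xs) = (p , dir x) ∷ curveFrom (p ⊕ dir x) xs

C : ℕ → List Segment
C n = curveFrom (+ 0 , + 0) (φ^ n (u ∷ []))

SelfAvoiding : List Segment → Set
SelfAvoiding = Unique

-- Since φᵐ⁺¹(x) = φᵐ(x₁) φᵐ(x₂), it suffices that the two halves of each such word never share
-- a segment.  Consider pairs of level-m curves of letters x, y whose starting points differ by
-- the projection of an offset h in the abelianisation ℤ³ of Ω, on which φ acts by a matrix A: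
-- a pair at level m + 1 splits into four pairs at level m, with offsets A h + (t − s) e₁ for
-- s, t ∈ {0, ±1}.  A expands a plane and contracts a line, and the indefinite form Q, negative
-- on the kernel of the projection, satisfies 50 (Q (A h + d e₁) − 22) ≥ 75 (Q h − 22) for
-- |d| ≤ 2.  So pairs with Q h ≥ 22 only split into such pairs and are not on top of each other
-- at level 0: they are disjoint at every level.  The finitely many other pairs reachable from
-- the six pairs (x₁, x₂) are enumerated, and their splittings and level-0 disjointness are
-- checked by evaluation.

module Submission where

open import Defs
open import Algebra.Bundles using (AbelianGroup)
open import Data.Bool using (Bool; true; T; _∧_)
open import Data.Empty using (⊥-elim)
open import Data.Integer as ℤ using (ℤ; +_; -_; _+_; _-_; _*_; _≤_; +≤+)
import Data.Integer.Properties as ℤ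
open import Data.Integer.Solver using (module +-*-Solver)
open import Data.List using (List; []; _∷_; _++_)
open import Data.List.Properties using (concatMap-++; ++-identityʳ)
open import Data.List.Membership.Propositional using (_∈_)
open import Data.List.Membership.Propositional.Properties using (∈-++⁻)
open import Data.List.Relation.Binary.Disjoint.Propositional using (Disjoint)
open import Data.List.Relation.Unary.All as All using (All; []; _∷_; all?)
open import Data.List.Relation.Unary.AllPairs using ([]; _∷_)
open import Data.List.Relation.Unary.Any using (here; there)
open import Data.List.Relation.Unary.Unique.Propositional using (Unique)
open import Data.List.Relation.Unary.Unique.Propositional.Properties using (++⁺)
open import Data.Nat as ℕ using (ℕ; zero; suc)
open import Data.Product using (_×_; _,_; proj₁; proj₂)
open import Data.Product.Properties using (≡-dec)
open import Data.Sum using (_⊎_; inj₁; inj₂)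
open import Function using (_∘_)
open import Relation.Binary.Definitions using (DecidableEquality)
open import Relation.Binary.PropositionalEquality
open import Relation.Nullary using (Dec; yes; no; does; ¬_; ¬?; contradiction)
open import Relation.Nullary.Decidable using (map′; _×-dec_; _⊎-dec_)

open import Algebra.Properties.Group (AbelianGroup.group ℤ.+-0-abelianGroup) using (∙-cancelˡ)
open ≡-Reasoning

first second : Letter → Letter
first u = u
first ū = ū
first v = u
first v̄ = ū
first w = ū
first w̄ = u
second u = v
second ū = v̄
second v = w
second v̄ = w̄
second w = w
second w̄ = w̄

φL-split : ∀ x → φL x ≡ first x ∷ second x ∷ []
φL-split u = refl
φL-split ū = refl
φL-split v = refl
φL-split v̄ = refl
φL-split w = refl
φL-split w̄ = refl

φ-++ : ∀ xs ys → φ (xs ++ ys) ≡ φ xs ++ φ ys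
φ-++ = concatMap-++ φL

φ^-++ : ∀ m xs ys → φ^ m (xs ++ ys) ≡ φ^ m xs ++ φ^ m ys
φ^-++ zero    xs ys = refl
φ^-++ (suc m) xs ys = trans (cong φ (φ^-++ m xs ys)) (φ-++ (φ^ m xs) (φ^ m ys))

φ^-suc : ∀ m xs → φ^ (suc m) xs ≡ φ^ m (φ xs)
φ^-suc zero    xs = refl
φ^-suc (suc m) xs = cong φ (φ^-suc m xs)

φ^-suc-[_] : ∀ x m → φ^ (suc m) (x ∷ []) ≡ φ^ m (first x ∷ []) ++ φ^ m (second x ∷ [])
φ^-suc-[ x ] m = begin
  φ^ (suc m) (x ∷ [])                       ≡⟨ φ^-suc m (x ∷ []) ⟩
  φ^ m (φL x ++ [])                         ≡⟨ cong (φ^ m) (trans (++-identityʳ (φL x)) (φL-split x)) ⟩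
  φ^ m (first x ∷ second x ∷ [])            ≡⟨ φ^-++ m (first x ∷ []) (second x ∷ []) ⟩
  φ^ m (first x ∷ []) ++ φ^ m (second x ∷ []) ∎

0ₚ : Point
0ₚ = (+ 0 , + 0)

⊕-identityʳ : ∀ p → p ⊕ 0ₚ ≡ p
⊕-identityʳ (a , b) = cong₂ _,_ (ℤ.+-identityʳ a) (ℤ.+-identityʳ b)

⊕-assoc : ∀ p q r → (p ⊕ q) ⊕ r ≡ p ⊕ (q ⊕ r)
⊕-assoc (a , b) (c , d) (e , f) = cong₂ _,_ (ℤ.+-assoc a c e) (ℤ.+-assoc b d f)

⊕-comm : ∀ p q → p ⊕ q ≡ q ⊕ p
⊕-comm (a , b) (c , d) = cong₂ _,_ (ℤ.+-comm a c) (ℤ.+-comm b d)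

⊕-cancelˡ : ∀ p q r → p ⊕ q ≡ p ⊕ r → q ≡ r
⊕-cancelˡ (a , b) (c , d) (e , f) eq =
  cong₂ _,_ (∙-cancelˡ a c e (cong proj₁ eq)) (∙-cancelˡ b d f (cong proj₂ eq))

_≟ₚ_ : DecidableEquality Point
_≟ₚ_ = ≡-dec ℤ._≟_ ℤ._≟_

record ℤ³ : Set where
  constructor ⟨_,_,_⟩
  field
    a b c : ℤ

0ᵥ : ℤ³
0ᵥ = ⟨ + 0 , + 0 , + 0 ⟩

e₁ : ℤ → ℤ³
e₁ d = ⟨ d , + 0 , + 0 ⟩

infixl 6 _+ᵥ_

_+ᵥ_ : ℤ³ → ℤ³ → ℤ³
⟨ a , b , c ⟩ +ᵥ ⟨ a′ , b′ , c′ ⟩ = ⟨ a + a′ , b + b′ , c + c′ ⟩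

⟨⟩-cong : ∀ {a a′ b b′ c c′} → a ≡ a′ → b ≡ b′ → c ≡ c′ → ⟨ a , b , c ⟩ ≡ ⟨ a′ , b′ , c′ ⟩
⟨⟩-cong refl refl refl = refl

+ᵥ-identityˡ : ∀ h → 0ᵥ +ᵥ h ≡ h
+ᵥ-identityˡ ⟨ a , b , c ⟩ = ⟨⟩-cong (ℤ.+-identityˡ a) (ℤ.+-identityˡ b) (ℤ.+-identityˡ c)

+ᵥ-assoc : ∀ f g h → (f +ᵥ g) +ᵥ h ≡ f +ᵥ (g +ᵥ h)
+ᵥ-assoc ⟨ a , b , c ⟩ ⟨ a′ , b′ , c′ ⟩ ⟨ a″ , b″ , c″ ⟩ =
  ⟨⟩-cong (ℤ.+-assoc a a′ a″) (ℤ.+-assoc b b′ b″) (ℤ.+-assoc c c′ c″)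

unit : Letter → ℤ³
unit u = ⟨ + 1 , + 0 , + 0 ⟩
unit ū = ⟨ - + 1 , + 0 , + 0 ⟩
unit v = ⟨ + 0 , + 1 , + 0 ⟩
unit v̄ = ⟨ + 0 , - + 1 , + 0 ⟩
unit w = ⟨ + 0 , + 0 , + 1 ⟩
unit w̄ = ⟨ + 0 , + 0 , - + 1 ⟩

ab : Word → ℤ³
ab []       = 0ᵥ
ab (x ∷ xs) = unit x +ᵥ ab xs

ab-++ : ∀ xs ys → ab (xs ++ ys) ≡ ab xs +ᵥ ab ys
ab-++ []       ys = sym (+ᵥ-identityˡ (ab ys))
ab-++ (x ∷ xs) ys = trans (cong (unit x +ᵥ_) (ab-++ xs ys)) (sym (+ᵥ-assoc (unit x) (ab xs) (ab ys)))

A : ℤ³ → ℤ³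
A ⟨ a , b , c ⟩ = ⟨ a + b - c , a , b + c ⟩

A-+ᵥ : ∀ g h → A (g +ᵥ h) ≡ A g +ᵥ A h
A-+ᵥ ⟨ a , b , c ⟩ ⟨ a′ , b′ , c′ ⟩ = ⟨⟩-cong
  (solve 6 (λ a b c a′ b′ c′ → (a :+ a′) :+ (b :+ b′) :- (c :+ c′) := (a :+ b :- c) :+ (a′ :+ b′ :- c′))
    refl a b c a′ b′ c′)
  refl
  (solve 4 (λ b c b′ c′ → (b :+ b′) :+ (c :+ c′) := (b :+ c) :+ (b′ :+ c′)) refl b c b′ c′)
  where open +-*-Solver

ab-φL : ∀ x → ab (φL x) ≡ A (unit x)
ab-φL u = refl
ab-φL ū = refl
ab-φL v = refl
ab-φL v̄ = refl
ab-φL w = refl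
ab-φL w̄ = refl

ab-φ : ∀ xs → ab (φ xs) ≡ A (ab xs)
ab-φ []       = refl
ab-φ (x ∷ xs) = begin
  ab (φL x ++ φ xs)          ≡⟨ ab-++ (φL x) (φ xs) ⟩
  ab (φL x) +ᵥ ab (φ xs)     ≡⟨ cong₂ _+ᵥ_ (ab-φL x) (ab-φ xs) ⟩
  A (unit x) +ᵥ A (ab xs)    ≡⟨ A-+ᵥ (unit x) (ab xs) ⟨
  A (unit x +ᵥ ab xs)        ∎

A^ : ℕ → ℤ³ → ℤ³
A^ zero    h = h
A^ (suc m) h = A^ m (A h)

A^-+ᵥ : ∀ m g h → A^ m (g +ᵥ h) ≡ A^ m g +ᵥ A^ m h
A^-+ᵥ zero    g h = refl
A^-+ᵥ (suc m) g h = trans (cong (A^ m) (A-+ᵥ g h)) (A^-+ᵥ m (A g) (A h))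

ab-φ^ : ∀ m xs → ab (φ^ m xs) ≡ A^ m (ab xs)
ab-φ^ zero    xs = refl
ab-φ^ (suc m) xs = begin
  ab (φ^ (suc m) xs)  ≡⟨ cong ab (φ^-suc m xs) ⟩
  ab (φ^ m (φ xs))    ≡⟨ ab-φ^ m (φ xs) ⟩
  A^ m (ab (φ xs))    ≡⟨ cong (A^ m) (ab-φ xs) ⟩
  A^ m (A (ab xs))    ∎

π : ℤ³ → Point
π ⟨ a , b , c ⟩ = (a , b + c)

π-+ᵥ : ∀ g h → π (g +ᵥ h) ≡ π g ⊕ π h
π-+ᵥ ⟨ a , b , c ⟩ ⟨ a′ , b′ , c′ ⟩ = cong (a + a′ ,_)
  (solve 4 (λ b c b′ c′ → (b :+ b′) :+ (c :+ c′) := (b :+ c) :+ (b′ :+ c′)) refl b c b′ c′)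
  where open +-*-Solver

dir≡π∘unit : ∀ x → dir x ≡ π (unit x)
dir≡π∘unit u = refl
dir≡π∘unit ū = refl
dir≡π∘unit v = refl
dir≡π∘unit v̄ = refl
dir≡π∘unit w = refl
dir≡π∘unit w̄ = refl

δ : ℕ → ℤ³ → Point
δ m h = π (A^ m h)

δ-+ᵥ : ∀ m g h → δ m (g +ᵥ h) ≡ δ m g ⊕ δ m h
δ-+ᵥ m g h = trans (cong π (A^-+ᵥ m g h)) (π-+ᵥ (A^ m g) (A^ m h))

δ-0ᵥ : ∀ m → δ m 0ᵥ ≡ 0ₚ
δ-0ᵥ zero    = refl
δ-0ᵥ (suc m) = δ-0ᵥ m

end : Point → Word → Point
end p []       = p
end p (x ∷ xs) = end (p ⊕ dir x) xs

curveFrom-++ : ∀ p xs ys → curveFrom p (xs ++ ys) ≡ curveFrom p xs ++ curveFrom (end p xs) ys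
curveFrom-++ p []       ys = refl
curveFrom-++ p (x ∷ xs) ys = cong ((p , dir x) ∷_) (curveFrom-++ (p ⊕ dir x) xs ys)

end≡⊕π∘ab : ∀ p xs → end p xs ≡ p ⊕ π (ab xs)
end≡⊕π∘ab p []       = sym (⊕-identityʳ p)
end≡⊕π∘ab p (x ∷ xs) = begin
  end (p ⊕ dir x) xs                 ≡⟨ end≡⊕π∘ab (p ⊕ dir x) xs ⟩
  (p ⊕ dir x) ⊕ π (ab xs)            ≡⟨ ⊕-assoc p (dir x) (π (ab xs)) ⟩
  p ⊕ (dir x ⊕ π (ab xs))            ≡⟨ cong (λ d → p ⊕ (d ⊕ π (ab xs))) (dir≡π∘unit x) ⟩
  p ⊕ (π (unit x) ⊕ π (ab xs))       ≡⟨ cong (p ⊕_) (π-+ᵥ (unit x) (ab xs)) ⟨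
  p ⊕ π (unit x +ᵥ ab xs)            ∎

curve : ℕ → Letter → Point → List Segment
curve m x p = curveFrom p (φ^ m (x ∷ []))

σ : Letter → ℤ
σ u = + 1
σ ū = - + 1
σ v = + 1
σ v̄ = - + 1
σ w = - + 1
σ w̄ = + 1

ab-first : ∀ x → ab (first x ∷ []) ≡ e₁ (σ x)
ab-first u = refl
ab-first ū = refl
ab-first v = refl
ab-first v̄ = refl
ab-first w = refl
ab-first w̄ = refl

curve-suc : ∀ m x p →
  curve (suc m) x p ≡ curve m (first x) p ++ curve m (second x) (p ⊕ δ m (e₁ (σ x)))
curve-suc m x p = begin
  curveFrom p (φ^ (suc m) (x ∷ []))
    ≡⟨ cong (curveFrom p) (φ^-suc-[ x ] m) ⟩
  curveFrom p (φ^ m (first x ∷ []) ++ φ^ m (second x ∷ []))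
    ≡⟨ curveFrom-++ p (φ^ m (first x ∷ [])) (φ^ m (second x ∷ [])) ⟩
  curve m (first x) p ++ curve m (second x) (end p (φ^ m (first x ∷ [])))
    ≡⟨ cong (λ q → curve m (first x) p ++ curve m (second x) q) end-first ⟩
  curve m (first x) p ++ curve m (second x) (p ⊕ δ m (e₁ (σ x)))
    ∎
  where
  end-first : end p (φ^ m (first x ∷ [])) ≡ p ⊕ δ m (e₁ (σ x))
  end-first = begin
    end p (φ^ m (first x ∷ []))            ≡⟨ end≡⊕π∘ab p (φ^ m (first x ∷ [])) ⟩
    p ⊕ π (ab (φ^ m (first x ∷ [])))       ≡⟨ cong (λ h → p ⊕ π h) (ab-φ^ m (first x ∷ [])) ⟩
    p ⊕ δ m (ab (first x ∷ []))            ≡⟨ cong (λ h → p ⊕ δ m h) (ab-first x) ⟩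
    p ⊕ δ m (e₁ (σ x))                     ∎

-- A h + (t − s) e₁, written out so that Q (step s t h) unfolds to a polynomial in h.
step : ℤ → ℤ → ℤ³ → ℤ³
step s t ⟨ a , b , c ⟩ = ⟨ a + b - c + t - s , a , b + c ⟩

step-+ᵥ-e₁ : ∀ s t h → step s t h +ᵥ e₁ s ≡ A h +ᵥ e₁ t
step-+ᵥ-e₁ s t ⟨ a , b , c ⟩ = ⟨⟩-cong
  (solve 5 (λ a b c s t → (a :+ b :- c :+ t :- s) :+ s := (a :+ b :- c) :+ t) refl a b c s t)
  refl refl
  where open +-*-Solver

record Pair : Set where
  constructor pair
  field
    left right : Letter
    offset     : ℤ³

Apart : ℕ → Pair → Set
Apart m (pair x y h) = ∀ p → Disjoint (curve m x p) (curve m y (p ⊕ δ m h))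

successors : Pair → List Pair
successors (pair x y h) =
  pair (first x)  (first y)  (step (+ 0) (+ 0) h) ∷
  pair (first x)  (second y) (step (+ 0) (σ y) h) ∷
  pair (second x) (first y)  (step (σ x) (+ 0) h) ∷
  pair (second x) (second y) (step (σ x) (σ y) h) ∷ []

halves-apart : ∀ m {x y h s t p p′ q′} → Apart m (pair x y (step s t h)) →
  p′ ≡ p ⊕ δ m (e₁ s) → q′ ≡ (p ⊕ δ (suc m) h) ⊕ δ m (e₁ t) →
  Disjoint (curve m x p′) (curve m y q′)
halves-apart m {x} {y} {h} {s} {t} {p} apart refl refl =
  subst (λ q → Disjoint (curve m x (p ⊕ δ m (e₁ s))) (curve m y q)) rebase (apart (p ⊕ δ m (e₁ s)))
  where
  rebase : (p ⊕ δ m (e₁ s)) ⊕ δ m (step s t h) ≡ (p ⊕ δ m (A h)) ⊕ δ m (e₁ t)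
  rebase = begin
    (p ⊕ δ m (e₁ s)) ⊕ δ m (step s t h)   ≡⟨ ⊕-assoc p _ _ ⟩
    p ⊕ (δ m (e₁ s) ⊕ δ m (step s t h))   ≡⟨ cong (p ⊕_) (⊕-comm (δ m (e₁ s)) _) ⟩
    p ⊕ (δ m (step s t h) ⊕ δ m (e₁ s))   ≡⟨ cong (p ⊕_) (δ-+ᵥ m (step s t h) (e₁ s)) ⟨
    p ⊕ δ m (step s t h +ᵥ e₁ s)          ≡⟨ cong (λ g → p ⊕ δ m g) (step-+ᵥ-e₁ s t h) ⟩
    p ⊕ δ m (A h +ᵥ e₁ t)                 ≡⟨ cong (p ⊕_) (δ-+ᵥ m (A h) (e₁ t)) ⟩
    p ⊕ (δ m (A h) ⊕ δ m (e₁ t))          ≡⟨ ⊕-assoc p _ _ ⟨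
    (p ⊕ δ m (A h)) ⊕ δ m (e₁ t)          ∎

⊕-δ-0ᵥ : ∀ m p → p ≡ p ⊕ δ m 0ᵥ
⊕-δ-0ᵥ m p = sym (trans (cong (p ⊕_) (δ-0ᵥ m)) (⊕-identityʳ p))

apart-suc : ∀ m s → All (Apart m) (successors s) → Apart (suc m) s
apart-suc m (pair x y h) (a₁₁ ∷ a₁₂ ∷ a₂₁ ∷ a₂₂ ∷ []) p {seg} (seg∈x , seg∈y)
  rewrite curve-suc m x p | curve-suc m y (p ⊕ δ (suc m) h)
  with ∈-++⁻ (curve m (first x) p) seg∈x | ∈-++⁻ (curve m (first y) (p ⊕ δ (suc m) h)) seg∈y
... | inj₁ i | inj₁ j = halves-apart m {p = p} a₁₁ (⊕-δ-0ᵥ m p) (⊕-δ-0ᵥ m _) (i , j)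
... | inj₁ i | inj₂ j = halves-apart m {p = p} a₁₂ (⊕-δ-0ᵥ m p) refl (i , j)
... | inj₂ i | inj₁ j = halves-apart m {p = p} a₂₁ refl (⊕-δ-0ᵥ m _) (i , j)
... | inj₂ i | inj₂ j = halves-apart m {p = p} a₂₂ refl refl (i , j)

Separated : Pair → Set
Separated (pair x y h) = ¬ (π h ≡ 0ₚ × dir x ≡ dir y)

apart-zero : ∀ s → Separated s → Apart 0 s
apart-zero (pair x y h) separated p (here refl , here eq) =
  separated (sym (⊕-cancelˡ p 0ₚ (π h) (trans (⊕-identityʳ p) (cong proj₁ eq))) , cong proj₂ eq)
apart-zero _ _ _ (here _  , there ())
apart-zero _ _ _ (there () , _)

Q : ℤ³ → ℤ
Q ⟨ a , b , c ⟩ = a * a + + 4 * a * b - + 2 * a * c - b * b + + 2 * b * c + + 2 * c * c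

Far : ℤ³ → Set
Far h = + 22 ≤ Q h

infix 9 _²

_² : ℤ → ℤ
i ² = i * i

²-nonNeg : ∀ i → + 0 ≤ i ²
²-nonNeg (+ zero)    = +≤+ ℕ.z≤n
²-nonNeg (+ suc n)   = +≤+ ℕ.z≤n
²-nonNeg ℤ.-[1+ n ] = +≤+ ℕ.z≤n

infixl 6 _⊞_

_⊞_ : ∀ {i j} → + 0 ≤ i → + 0 ≤ j → + 0 ≤ i + j
_⊞_ = ℤ.+-mono-≤

scaled : ∀ n {i} → + 0 ≤ i → + 0 ≤ + n * i
scaled n {i} 0≤i = subst (_≤ + n * i) (ℤ.*-zeroʳ (+ n)) (ℤ.*-monoˡ-≤-nonNeg (+ n) 0≤i)

surplus : ℤ → ℤ → ℤ → ℤ → ℤ → ℤ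
surplus a b c s t =
  + 5 * (+ 5 * a - + 3 * c + + 6 * (t - s)) ² + + 5 * (+ 5 * b - c) ² + + 2 * (+ 5 * c - (t - s)) ²
  + + 132 * (s + t) ² + + 264 * (+ 1 - s ²) + + 264 * (+ 1 - t ²) + + 22

expansion : ∀ a b c s t →
  + 50 * (Q (step s t ⟨ a , b , c ⟩) - + 22) ≡ + 75 * (Q ⟨ a , b , c ⟩ - + 22) + surplus a b c s t
expansion = solve 5 (λ a b c s t →
  let q : _ → _ → _ → _
      q x y z = x :* x :+ con (+ 4) :* x :* y :- con (+ 2) :* x :* z :- y :* y
                :+ con (+ 2) :* y :* z :+ con (+ 2) :* z :* z
      sq : _ → _
      sq x = x :* x
  in  con (+ 50) :* (q (a :+ b :- c :+ t :- s) a (b :+ c) :- con (+ 22))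
      := con (+ 75) :* (q a b c :- con (+ 22))
         :+ (con (+ 5) :* sq (con (+ 5) :* a :- con (+ 3) :* c :+ con (+ 6) :* (t :- s))
             :+ con (+ 5) :* sq (con (+ 5) :* b :- c) :+ con (+ 2) :* sq (con (+ 5) :* c :- (t :- s))
             :+ con (+ 132) :* sq (s :+ t) :+ con (+ 264) :* (con (+ 1) :- sq s)
             :+ con (+ 264) :* (con (+ 1) :- sq t) :+ con (+ 22)))
  refl
  where open +-*-Solver

surplus-nonNeg : ∀ a b c s t → s ² ≤ + 1 → t ² ≤ + 1 → + 0 ≤ surplus a b c s t
surplus-nonNeg a b c s t s²≤1 t²≤1 =
  scaled 5 (²-nonNeg (+ 5 * a - + 3 * c + + 6 * (t - s))) ⊞ scaled 5 (²-nonNeg (+ 5 * b - c))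
  ⊞ scaled 2 (²-nonNeg (+ 5 * c - (t - s))) ⊞ scaled 132 (²-nonNeg (s + t))
  ⊞ scaled 264 (ℤ.i≤j⇒0≤j-i s²≤1) ⊞ scaled 264 (ℤ.i≤j⇒0≤j-i t²≤1) ⊞ +≤+ ℕ.z≤n

far-step : ∀ s t h → s ² ≤ + 1 → t ² ≤ + 1 → Far h → Far (step s t h)
far-step s t ⟨ a , b , c ⟩ s²≤1 t²≤1 far =
  ℤ.0≤i-j⇒j≤i (ℤ.*-cancelˡ-≤-pos (+ 0) _ (+ 50) (subst (+ 0 ≤_) (sym (expansion a b c s t))
    (scaled 75 (ℤ.i≤j⇒0≤j-i far) ⊞ surplus-nonNeg a b c s t s²≤1 t²≤1)))

-- On the kernel of π, that is a = 0 and c = −b, the form Q is −b².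
Q-kernel : ∀ a b c → Q ⟨ a , b , c ⟩ ≡ a * (a + + 4 * b - + 2 * c) + (b + c) * (+ 2 * c) - b ²
Q-kernel = solve 3 (λ a b c →
  a :* a :+ con (+ 4) :* a :* b :- con (+ 2) :* a :* c :- b :* b :+ con (+ 2) :* b :* c :+ con (+ 2) :* c :* c
  := a :* (a :+ con (+ 4) :* b :- con (+ 2) :* c) :+ (b :+ c) :* (con (+ 2) :* c) :- b :* b) refl
  where open +-*-Solver

far⇒π≢0ₚ : ∀ h → Far h → π h ≢ 0ₚ
far⇒π≢0ₚ ⟨ a , b , c ⟩ far πh≡0 =
  contradiction (ℤ.≤-trans far (ℤ.≤-trans (ℤ.≤-reflexive Q≡-b²) (ℤ.neg-mono-≤ (²-nonNeg b)))) λ { (+≤+ ()) }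
  where
  Q≡-b² : Q ⟨ a , b , c ⟩ ≡ - b ²
  Q≡-b² = begin
    Q ⟨ a , b , c ⟩
      ≡⟨ Q-kernel a b c ⟩
    a * (a + + 4 * b - + 2 * c) + (b + c) * (+ 2 * c) - b ²
      ≡⟨ cong₂ (λ a′ s′ → a′ * (a + + 4 * b - + 2 * c) + s′ * (+ 2 * c) - b ²)
               (cong proj₁ πh≡0) (cong proj₂ πh≡0) ⟩
    + 0 - b ²
      ≡⟨ ℤ.+-identityˡ (- b ²) ⟩
    - b ² ∎

index : Letter → ℕ
index u = 0
index ū = 1
index v = 2
index v̄ = 3
index w = 4
index w̄ = 5

letterAt : ℕ → Letter
letterAt 0 = u
letterAt 1 = ū
letterAt 2 = v
letterAt 3 = v̄
letterAt 4 = w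
letterAt _ = w̄

letterAt-index : ∀ x → letterAt (index x) ≡ x
letterAt-index u = refl
letterAt-index ū = refl
letterAt-index v = refl
letterAt-index v̄ = refl
letterAt-index w = refl
letterAt-index w̄ = refl

_≟ᴸ_ : DecidableEquality Letter
x ≟ᴸ y = map′ index-injective (cong index) (index x ℕ.≟ index y)
  where
  index-injective : index x ≡ index y → x ≡ y
  index-injective eq = trans (sym (letterAt-index x)) (trans (cong letterAt eq) (letterAt-index y))

_≟ᵥ_ : DecidableEquality ℤ³
⟨ a , b , c ⟩ ≟ᵥ ⟨ a′ , b′ , c′ ⟩ =
  map′ (λ { (refl , refl , refl) → refl }) (λ { refl → refl , refl , refl })
    (a ℤ.≟ a′ ×-dec b ℤ.≟ b′ ×-dec c ℤ.≟ c′)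

_≟ᴾ_ : DecidableEquality Pair
pair x y h ≟ᴾ pair x′ y′ h′ =
  map′ (λ { (refl , refl , refl) → refl }) (λ { refl → refl , refl , refl })
    (x ≟ᴸ x′ ×-dec y ≟ᴸ y′ ×-dec h ≟ᵥ h′)

open import Data.List.Membership.DecPropositional _≟ᴾ_ using (_∈?_)

-- Normalising all? would also build its evidence; evaluating only the Booleans is much cheaper.
module _ {A : Set} {P : A → Set} (P? : ∀ x → Dec (P x)) where

  allYes : List A → Bool
  allYes []       = true
  allYes (x ∷ xs) = does (P? x) ∧ allYes xs

  allYes⇒All : ∀ xs → T (allYes xs) → All P xs
  allYes⇒All []       _     = []
  allYes⇒All (x ∷ xs) holds with P? x
  ... | yes px = px ∷ allYes⇒All xs holds
  ... | no  _  = ⊥-elim holds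

far? : ∀ h → Dec (Far h)
far? h = + 22 ℤ.≤? Q h

separated? : ∀ s → Dec (Separated s)
separated? (pair x y h) = ¬? (π h ≟ₚ 0ₚ ×-dec dir x ≟ₚ dir y)

start : Letter → Pair
start x = pair (first x) (second x) (e₁ (σ x))

-- The pairs reachable from the start pairs by splitting without ever becoming far, in
-- breadth-first order (so the start pairs come first).
nearPairs : List Pair
nearPairs =
  pair u v ⟨ + 1 , + 0 , + 0 ⟩ ∷ pair ū v̄ ⟨ - + 1 , + 0 , + 0 ⟩ ∷ pair u w ⟨ + 1 , + 0 , + 0 ⟩ ∷
  pair ū w̄ ⟨ - + 1 , + 0 , + 0 ⟩ ∷ pair ū w ⟨ - + 1 , + 0 , + 0 ⟩ ∷ pair u w̄ ⟨ + 1 , + 0 , + 0 ⟩ ∷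
  pair u u ⟨ + 1 , + 1 , + 0 ⟩ ∷ pair u w ⟨ + 2 , + 1 , + 0 ⟩ ∷ pair v u ⟨ + 0 , + 1 , + 0 ⟩ ∷
  pair v w ⟨ + 1 , + 1 , + 0 ⟩ ∷ pair ū ū ⟨ - + 1 , - + 1 , + 0 ⟩ ∷ pair ū w̄ ⟨ - + 2 , - + 1 , + 0 ⟩ ∷
  pair v̄ ū ⟨ + 0 , - + 1 , + 0 ⟩ ∷ pair v̄ w̄ ⟨ - + 1 , - + 1 , + 0 ⟩ ∷ pair u ū ⟨ + 1 , + 1 , + 0 ⟩ ∷
  pair u w ⟨ + 0 , + 1 , + 0 ⟩ ∷ pair v ū ⟨ + 0 , + 1 , + 0 ⟩ ∷ pair v w ⟨ - + 1 , + 1 , + 0 ⟩ ∷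
  pair ū u ⟨ - + 1 , - + 1 , + 0 ⟩ ∷ pair ū w̄ ⟨ + 0 , - + 1 , + 0 ⟩ ∷ pair v̄ u ⟨ + 0 , - + 1 , + 0 ⟩ ∷
  pair v̄ w̄ ⟨ + 1 , - + 1 , + 0 ⟩ ∷ pair ū w ⟨ - + 2 , - + 1 , + 0 ⟩ ∷ pair v̄ w ⟨ - + 1 , - + 1 , + 0 ⟩ ∷
  pair u w̄ ⟨ + 2 , + 1 , + 0 ⟩ ∷ pair v w̄ ⟨ + 1 , + 1 , + 0 ⟩ ∷ pair u u ⟨ + 2 , + 1 , + 1 ⟩ ∷
  pair u v ⟨ + 3 , + 1 , + 1 ⟩ ∷ pair v u ⟨ + 1 , + 1 , + 1 ⟩ ∷ pair v v ⟨ + 2 , + 1 , + 1 ⟩ ∷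
  pair u w ⟨ + 2 , + 2 , + 1 ⟩ ∷ pair v ū ⟨ + 2 , + 2 , + 1 ⟩ ∷ pair v w ⟨ + 1 , + 2 , + 1 ⟩ ∷
  pair u u ⟨ + 1 , + 0 , + 1 ⟩ ∷ pair u v ⟨ + 2 , + 0 , + 1 ⟩ ∷ pair w u ⟨ + 0 , + 0 , + 1 ⟩ ∷
  pair w v ⟨ + 1 , + 0 , + 1 ⟩ ∷ pair u ū ⟨ + 2 , + 1 , + 1 ⟩ ∷ pair u w ⟨ + 1 , + 1 , + 1 ⟩ ∷
  pair w ū ⟨ + 1 , + 1 , + 1 ⟩ ∷ pair w w ⟨ + 0 , + 1 , + 1 ⟩ ∷ pair ū ū ⟨ - + 2 , - + 1 , - + 1 ⟩ ∷
  pair ū v̄ ⟨ - + 3 , - + 1 , - + 1 ⟩ ∷ pair v̄ ū ⟨ - + 1 , - + 1 , - + 1 ⟩ ∷ pair v̄ v̄ ⟨ - + 2 , - + 1 , - + 1 ⟩ ∷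
  pair ū w̄ ⟨ - + 2 , - + 2 , - + 1 ⟩ ∷ pair v̄ u ⟨ - + 2 , - + 2 , - + 1 ⟩ ∷ pair v̄ w̄ ⟨ - + 1 , - + 2 , - + 1 ⟩ ∷
  pair ū ū ⟨ - + 1 , + 0 , - + 1 ⟩ ∷ pair ū v̄ ⟨ - + 2 , + 0 , - + 1 ⟩ ∷ pair w̄ ū ⟨ + 0 , + 0 , - + 1 ⟩ ∷
  pair w̄ v̄ ⟨ - + 1 , + 0 , - + 1 ⟩ ∷ pair ū u ⟨ - + 2 , - + 1 , - + 1 ⟩ ∷ pair ū w̄ ⟨ - + 1 , - + 1 , - + 1 ⟩ ∷
  pair w̄ u ⟨ - + 1 , - + 1 , - + 1 ⟩ ∷ pair w̄ w̄ ⟨ + 0 , - + 1 , - + 1 ⟩ ∷ pair u v̄ ⟨ + 1 , + 1 , + 1 ⟩ ∷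
  pair v ū ⟨ + 1 , + 1 , + 1 ⟩ ∷ pair v v̄ ⟨ + 0 , + 1 , + 1 ⟩ ∷ pair u ū ⟨ + 1 , + 0 , + 1 ⟩ ∷
  pair u w ⟨ + 0 , + 0 , + 1 ⟩ ∷ pair v ū ⟨ + 0 , + 0 , + 1 ⟩ ∷ pair v w ⟨ - + 1 , + 0 , + 1 ⟩ ∷
  pair u v̄ ⟨ + 0 , + 0 , + 1 ⟩ ∷ pair w ū ⟨ + 0 , + 0 , + 1 ⟩ ∷ pair w v̄ ⟨ - + 1 , + 0 , + 1 ⟩ ∷
  pair u ū ⟨ + 0 , - + 1 , + 1 ⟩ ∷ pair u w ⟨ - + 1 , - + 1 , + 1 ⟩ ∷ pair w ū ⟨ - + 1 , - + 1 , + 1 ⟩ ∷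
  pair w w ⟨ - + 2 , - + 1 , + 1 ⟩ ∷ pair ū v ⟨ - + 1 , - + 1 , - + 1 ⟩ ∷ pair v̄ u ⟨ - + 1 , - + 1 , - + 1 ⟩ ∷
  pair v̄ v ⟨ + 0 , - + 1 , - + 1 ⟩ ∷ pair ū u ⟨ - + 1 , + 0 , - + 1 ⟩ ∷ pair ū w̄ ⟨ + 0 , + 0 , - + 1 ⟩ ∷
  pair v̄ u ⟨ + 0 , + 0 , - + 1 ⟩ ∷ pair v̄ w̄ ⟨ + 1 , + 0 , - + 1 ⟩ ∷ pair ū v ⟨ + 0 , + 0 , - + 1 ⟩ ∷
  pair w̄ u ⟨ + 0 , + 0 , - + 1 ⟩ ∷ pair w̄ v ⟨ + 1 , + 0 , - + 1 ⟩ ∷ pair ū u ⟨ + 0 , + 1 , - + 1 ⟩ ∷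
  pair ū w̄ ⟨ + 1 , + 1 , - + 1 ⟩ ∷ pair w̄ u ⟨ + 1 , + 1 , - + 1 ⟩ ∷ pair w̄ w̄ ⟨ + 2 , + 1 , - + 1 ⟩ ∷
  pair v̄ ū ⟨ - + 2 , - + 2 , - + 1 ⟩ ∷ pair ū w ⟨ - + 3 , - + 1 , - + 1 ⟩ ∷ pair w̄ ū ⟨ - + 1 , - + 1 , - + 1 ⟩ ∷
  pair w̄ w ⟨ - + 2 , - + 1 , - + 1 ⟩ ∷ pair v u ⟨ + 2 , + 2 , + 1 ⟩ ∷ pair u w̄ ⟨ + 3 , + 1 , + 1 ⟩ ∷
  pair w u ⟨ + 1 , + 1 , + 1 ⟩ ∷ pair w w̄ ⟨ + 2 , + 1 , + 1 ⟩ ∷ pair v u ⟨ + 1 , + 2 , + 2 ⟩ ∷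
  pair u u ⟨ + 1 , + 1 , + 2 ⟩ ∷ pair u v ⟨ + 2 , + 1 , + 2 ⟩ ∷ pair w u ⟨ + 0 , + 1 , + 2 ⟩ ∷
  pair w v ⟨ + 1 , + 1 , + 2 ⟩ ∷ pair w u ⟨ + 1 , + 2 , + 2 ⟩ ∷ pair u u ⟨ + 0 , + 1 , + 1 ⟩ ∷
  pair u v ⟨ + 1 , + 1 , + 1 ⟩ ∷ pair v u ⟨ - + 1 , + 1 , + 1 ⟩ ∷ pair v v ⟨ + 0 , + 1 , + 1 ⟩ ∷
  pair u u ⟨ + 1 , + 2 , + 1 ⟩ ∷ pair v u ⟨ + 0 , + 2 , + 1 ⟩ ∷ pair ū u ⟨ - + 1 , + 0 , + 1 ⟩ ∷
  pair ū v ⟨ + 0 , + 0 , + 1 ⟩ ∷ pair ū u ⟨ + 0 , + 1 , + 1 ⟩ ∷ pair ū w ⟨ + 1 , + 1 , + 1 ⟩ ∷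
  pair w w ⟨ + 2 , + 1 , + 1 ⟩ ∷ pair u v̄ ⟨ + 1 , + 2 , + 2 ⟩ ∷ pair v ū ⟨ + 1 , + 2 , + 2 ⟩ ∷
  pair v v̄ ⟨ + 0 , + 2 , + 2 ⟩ ∷ pair u ū ⟨ + 1 , + 1 , + 2 ⟩ ∷ pair u w ⟨ + 0 , + 1 , + 2 ⟩ ∷
  pair v ū ⟨ + 0 , + 1 , + 2 ⟩ ∷ pair v w ⟨ - + 1 , + 1 , + 2 ⟩ ∷ pair ū ū ⟨ + 1 , + 1 , + 2 ⟩ ∷
  pair ū v̄ ⟨ + 0 , + 1 , + 2 ⟩ ∷ pair w ū ⟨ + 2 , + 1 , + 2 ⟩ ∷ pair w v̄ ⟨ + 1 , + 1 , + 2 ⟩ ∷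
  pair ū ū ⟨ + 0 , + 0 , + 2 ⟩ ∷ pair ū w ⟨ - + 1 , + 0 , + 2 ⟩ ∷ pair w ū ⟨ + 1 , + 0 , + 2 ⟩ ∷
  pair w w ⟨ + 0 , + 0 , + 2 ⟩ ∷ pair v̄ ū ⟨ - + 1 , - + 2 , - + 2 ⟩ ∷ pair ū ū ⟨ - + 1 , - + 1 , - + 2 ⟩ ∷
  pair ū v̄ ⟨ - + 2 , - + 1 , - + 2 ⟩ ∷ pair w̄ ū ⟨ + 0 , - + 1 , - + 2 ⟩ ∷ pair w̄ v̄ ⟨ - + 1 , - + 1 , - + 2 ⟩ ∷
  pair w̄ ū ⟨ - + 1 , - + 2 , - + 2 ⟩ ∷ pair ū ū ⟨ + 0 , - + 1 , - + 1 ⟩ ∷ pair ū v̄ ⟨ - + 1 , - + 1 , - + 1 ⟩ ∷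
  pair v̄ ū ⟨ + 1 , - + 1 , - + 1 ⟩ ∷ pair v̄ v̄ ⟨ + 0 , - + 1 , - + 1 ⟩ ∷ pair ū ū ⟨ - + 1 , - + 2 , - + 1 ⟩ ∷
  pair v̄ ū ⟨ + 0 , - + 2 , - + 1 ⟩ ∷ pair u ū ⟨ + 1 , + 0 , - + 1 ⟩ ∷ pair u v̄ ⟨ + 0 , + 0 , - + 1 ⟩ ∷
  pair u ū ⟨ + 0 , - + 1 , - + 1 ⟩ ∷ pair u w̄ ⟨ - + 1 , - + 1 , - + 1 ⟩ ∷ pair w̄ w̄ ⟨ - + 2 , - + 1 , - + 1 ⟩ ∷
  pair ū v ⟨ - + 1 , - + 2 , - + 2 ⟩ ∷ pair v̄ u ⟨ - + 1 , - + 2 , - + 2 ⟩ ∷ pair v̄ v ⟨ + 0 , - + 2 , - + 2 ⟩ ∷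
  pair ū u ⟨ - + 1 , - + 1 , - + 2 ⟩ ∷ pair ū w̄ ⟨ + 0 , - + 1 , - + 2 ⟩ ∷ pair v̄ u ⟨ + 0 , - + 1 , - + 2 ⟩ ∷
  pair v̄ w̄ ⟨ + 1 , - + 1 , - + 2 ⟩ ∷ pair u u ⟨ - + 1 , - + 1 , - + 2 ⟩ ∷ pair u v ⟨ + 0 , - + 1 , - + 2 ⟩ ∷
  pair w̄ u ⟨ - + 2 , - + 1 , - + 2 ⟩ ∷ pair w̄ v ⟨ - + 1 , - + 1 , - + 2 ⟩ ∷ pair u u ⟨ + 0 , + 0 , - + 2 ⟩ ∷
  pair u w̄ ⟨ + 1 , + 0 , - + 2 ⟩ ∷ pair w̄ u ⟨ - + 1 , + 0 , - + 2 ⟩ ∷ pair w̄ w̄ ⟨ + 0 , + 0 , - + 2 ⟩ ∷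
  pair u w̄ ⟨ + 0 , + 1 , + 2 ⟩ ∷ pair v w̄ ⟨ - + 1 , + 1 , + 2 ⟩ ∷ pair u v̄ ⟨ + 0 , + 1 , + 2 ⟩ ∷
  pair w ū ⟨ + 0 , + 1 , + 2 ⟩ ∷ pair w v̄ ⟨ - + 1 , + 1 , + 2 ⟩ ∷ pair u ū ⟨ + 0 , + 0 , + 2 ⟩ ∷
  pair u w̄ ⟨ - + 1 , + 0 , + 2 ⟩ ∷ pair w ū ⟨ - + 1 , + 0 , + 2 ⟩ ∷ pair w w̄ ⟨ - + 2 , + 0 , + 2 ⟩ ∷
  pair u ū ⟨ + 0 , + 1 , + 1 ⟩ ∷ pair u v̄ ⟨ - + 1 , + 1 , + 1 ⟩ ∷ pair v ū ⟨ - + 1 , + 1 , + 1 ⟩ ∷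
  pair v v̄ ⟨ - + 2 , + 1 , + 1 ⟩ ∷ pair u ū ⟨ - + 1 , + 0 , + 1 ⟩ ∷ pair u w ⟨ - + 2 , + 0 , + 1 ⟩ ∷
  pair v ū ⟨ - + 2 , + 0 , + 1 ⟩ ∷ pair v w ⟨ - + 3 , + 0 , + 1 ⟩ ∷ pair u v̄ ⟨ - + 2 , + 0 , + 1 ⟩ ∷
  pair w ū ⟨ - + 2 , + 0 , + 1 ⟩ ∷ pair w v̄ ⟨ - + 3 , + 0 , + 1 ⟩ ∷ pair u ū ⟨ - + 2 , - + 1 , + 1 ⟩ ∷
  pair u w̄ ⟨ - + 2 , + 0 , + 1 ⟩ ∷ pair v w̄ ⟨ - + 3 , + 0 , + 1 ⟩ ∷ pair ū ū ⟨ - + 1 , + 0 , + 1 ⟩ ∷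
  pair ū v̄ ⟨ - + 2 , + 0 , + 1 ⟩ ∷ pair ū ū ⟨ - + 2 , - + 1 , + 1 ⟩ ∷ pair w w̄ ⟨ - + 2 , - + 1 , + 1 ⟩ ∷
  pair u ū ⟨ - + 2 , + 0 , + 0 ⟩ ∷ pair u v̄ ⟨ - + 3 , + 0 , + 0 ⟩ ∷ pair v ū ⟨ - + 3 , + 0 , + 0 ⟩ ∷
  pair v v̄ ⟨ - + 4 , + 0 , + 0 ⟩ ∷ pair u ū ⟨ - + 3 , - + 1 , + 0 ⟩ ∷ pair ū ū ⟨ - + 3 , - + 1 , + 0 ⟩ ∷
  pair w ū ⟨ - + 2 , - + 1 , + 0 ⟩ ∷ pair w v̄ ⟨ - + 3 , - + 1 , + 0 ⟩ ∷ pair ū w ⟨ + 0 , - + 1 , - + 2 ⟩ ∷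
  pair v̄ w ⟨ + 1 , - + 1 , - + 2 ⟩ ∷ pair ū v ⟨ + 0 , - + 1 , - + 2 ⟩ ∷ pair w̄ u ⟨ + 0 , - + 1 , - + 2 ⟩ ∷
  pair w̄ v ⟨ + 1 , - + 1 , - + 2 ⟩ ∷ pair ū u ⟨ + 0 , + 0 , - + 2 ⟩ ∷ pair ū w ⟨ + 1 , + 0 , - + 2 ⟩ ∷
  pair w̄ u ⟨ + 1 , + 0 , - + 2 ⟩ ∷ pair w̄ w ⟨ + 2 , + 0 , - + 2 ⟩ ∷ pair ū u ⟨ + 0 , - + 1 , - + 1 ⟩ ∷
  pair ū v ⟨ + 1 , - + 1 , - + 1 ⟩ ∷ pair v̄ u ⟨ + 1 , - + 1 , - + 1 ⟩ ∷ pair v̄ v ⟨ + 2 , - + 1 , - + 1 ⟩ ∷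
  pair ū u ⟨ + 1 , + 0 , - + 1 ⟩ ∷ pair ū w̄ ⟨ + 2 , + 0 , - + 1 ⟩ ∷ pair v̄ u ⟨ + 2 , + 0 , - + 1 ⟩ ∷
  pair v̄ w̄ ⟨ + 3 , + 0 , - + 1 ⟩ ∷ pair ū v ⟨ + 2 , + 0 , - + 1 ⟩ ∷ pair w̄ u ⟨ + 2 , + 0 , - + 1 ⟩ ∷
  pair w̄ v ⟨ + 3 , + 0 , - + 1 ⟩ ∷ pair ū u ⟨ + 2 , + 1 , - + 1 ⟩ ∷ pair ū w ⟨ + 2 , + 0 , - + 1 ⟩ ∷
  pair v̄ w ⟨ + 3 , + 0 , - + 1 ⟩ ∷ pair u u ⟨ + 1 , + 0 , - + 1 ⟩ ∷ pair u v ⟨ + 2 , + 0 , - + 1 ⟩ ∷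
  pair u u ⟨ + 2 , + 1 , - + 1 ⟩ ∷ pair w̄ w ⟨ + 2 , + 1 , - + 1 ⟩ ∷ pair ū u ⟨ + 2 , + 0 , + 0 ⟩ ∷
  pair ū v ⟨ + 3 , + 0 , + 0 ⟩ ∷ pair v̄ u ⟨ + 3 , + 0 , + 0 ⟩ ∷ pair v̄ v ⟨ + 4 , + 0 , + 0 ⟩ ∷
  pair ū u ⟨ + 3 , + 1 , + 0 ⟩ ∷ pair u u ⟨ + 3 , + 1 , + 0 ⟩ ∷ pair w̄ u ⟨ + 2 , + 1 , + 0 ⟩ ∷
  pair w̄ v ⟨ + 3 , + 1 , + 0 ⟩ ∷ pair u ū ⟨ - + 1 , - + 1 , - + 2 ⟩ ∷ pair u v̄ ⟨ - + 2 , - + 1 , - + 2 ⟩ ∷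
  pair w̄ ū ⟨ - + 2 , - + 1 , - + 2 ⟩ ∷ pair w̄ v̄ ⟨ - + 3 , - + 1 , - + 2 ⟩ ∷ pair ū u ⟨ + 1 , + 1 , + 2 ⟩ ∷
  pair ū v ⟨ + 2 , + 1 , + 2 ⟩ ∷ pair w u ⟨ + 2 , + 1 , + 2 ⟩ ∷ pair w v ⟨ + 3 , + 1 , + 2 ⟩ ∷
  pair ū v ⟨ + 0 , + 0 , + 3 ⟩ ∷ pair w u ⟨ + 0 , + 0 , + 3 ⟩ ∷ pair w v ⟨ + 1 , + 0 , + 3 ⟩ ∷
  pair u u ⟨ + 0 , + 0 , + 2 ⟩ ∷ pair u v ⟨ + 1 , + 0 , + 2 ⟩ ∷ pair v u ⟨ - + 1 , + 0 , + 2 ⟩ ∷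
  pair v v ⟨ + 0 , + 0 , + 2 ⟩ ∷ pair u w ⟨ + 2 , + 1 , + 2 ⟩ ∷ pair v u ⟨ + 0 , + 1 , + 2 ⟩ ∷
  pair v w ⟨ + 1 , + 1 , + 2 ⟩ ∷ pair u u ⟨ - + 1 , - + 1 , + 2 ⟩ ∷ pair u v ⟨ + 0 , - + 1 , + 2 ⟩ ∷
  pair w v ⟨ - + 1 , - + 1 , + 2 ⟩ ∷ pair u w ⟨ + 1 , + 0 , + 2 ⟩ ∷ pair w u ⟨ - + 1 , + 0 , + 2 ⟩ ∷
  pair u u ⟨ + 1 , + 0 , + 3 ⟩ ∷ pair u v ⟨ + 2 , + 0 , + 3 ⟩ ∷ pair ū u ⟨ - + 2 , - + 1 , + 1 ⟩ ∷
  pair ū v ⟨ - + 1 , - + 1 , + 1 ⟩ ∷ pair v̄ u ⟨ - + 1 , - + 1 , + 1 ⟩ ∷ pair v̄ v ⟨ + 0 , - + 1 , + 1 ⟩ ∷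
  pair ū w ⟨ + 0 , + 0 , + 1 ⟩ ∷ pair v̄ u ⟨ + 0 , + 0 , + 1 ⟩ ∷ pair v̄ w ⟨ + 1 , + 0 , + 1 ⟩ ∷
  pair ū u ⟨ + 0 , + 0 , + 2 ⟩ ∷ pair ū v ⟨ + 1 , + 0 , + 2 ⟩ ∷ pair v̄ u ⟨ + 1 , + 0 , + 2 ⟩ ∷
  pair v̄ v ⟨ + 2 , + 0 , + 2 ⟩ ∷ pair ū w ⟨ + 0 , + 1 , + 2 ⟩ ∷ pair v̄ ū ⟨ + 2 , + 1 , + 2 ⟩ ∷
  pair v̄ w ⟨ + 1 , + 1 , + 2 ⟩ ∷ pair ū w ⟨ + 1 , + 2 , + 2 ⟩ ∷ pair v̄ ū ⟨ + 0 , + 0 , + 3 ⟩ ∷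
  pair ū ū ⟨ - + 2 , + 0 , + 2 ⟩ ∷ pair v̄ ū ⟨ - + 1 , + 0 , + 2 ⟩ ∷ pair v̄ v̄ ⟨ - + 2 , + 0 , + 2 ⟩ ∷
  pair ū ū ⟨ - + 1 , + 1 , + 2 ⟩ ∷ pair ū v̄ ⟨ - + 2 , + 1 , + 2 ⟩ ∷ pair w w ⟨ - + 2 , + 0 , + 2 ⟩ ∷
  pair u v̄ ⟨ + 0 , + 0 , - + 3 ⟩ ∷ pair w̄ ū ⟨ + 0 , + 0 , - + 3 ⟩ ∷ pair w̄ v̄ ⟨ - + 1 , + 0 , - + 3 ⟩ ∷
  pair ū ū ⟨ + 0 , + 0 , - + 2 ⟩ ∷ pair ū v̄ ⟨ - + 1 , + 0 , - + 2 ⟩ ∷ pair v̄ ū ⟨ + 1 , + 0 , - + 2 ⟩ ∷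
  pair v̄ v̄ ⟨ + 0 , + 0 , - + 2 ⟩ ∷ pair ū w̄ ⟨ - + 2 , - + 1 , - + 2 ⟩ ∷ pair v̄ ū ⟨ + 0 , - + 1 , - + 2 ⟩ ∷
  pair v̄ w̄ ⟨ - + 1 , - + 1 , - + 2 ⟩ ∷ pair ū ū ⟨ + 1 , + 1 , - + 2 ⟩ ∷ pair ū v̄ ⟨ + 0 , + 1 , - + 2 ⟩ ∷
  pair w̄ v̄ ⟨ + 1 , + 1 , - + 2 ⟩ ∷ pair ū w̄ ⟨ - + 1 , + 0 , - + 2 ⟩ ∷ pair w̄ ū ⟨ + 1 , + 0 , - + 2 ⟩ ∷
  pair ū ū ⟨ - + 1 , + 0 , - + 3 ⟩ ∷ pair ū v̄ ⟨ - + 2 , + 0 , - + 3 ⟩ ∷ pair u ū ⟨ + 2 , + 1 , - + 1 ⟩ ∷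
  pair u v̄ ⟨ + 1 , + 1 , - + 1 ⟩ ∷ pair v ū ⟨ + 1 , + 1 , - + 1 ⟩ ∷ pair v v̄ ⟨ + 0 , + 1 , - + 1 ⟩ ∷
  pair u w̄ ⟨ + 0 , + 0 , - + 1 ⟩ ∷ pair v ū ⟨ + 0 , + 0 , - + 1 ⟩ ∷ pair v w̄ ⟨ - + 1 , + 0 , - + 1 ⟩ ∷
  pair u ū ⟨ + 0 , + 0 , - + 2 ⟩ ∷ pair u v̄ ⟨ - + 1 , + 0 , - + 2 ⟩ ∷ pair v ū ⟨ - + 1 , + 0 , - + 2 ⟩ ∷
  pair v v̄ ⟨ - + 2 , + 0 , - + 2 ⟩ ∷ pair u w̄ ⟨ + 0 , - + 1 , - + 2 ⟩ ∷ pair v u ⟨ - + 2 , - + 1 , - + 2 ⟩ ∷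
  pair v w̄ ⟨ - + 1 , - + 1 , - + 2 ⟩ ∷ pair u w̄ ⟨ - + 1 , - + 2 , - + 2 ⟩ ∷ pair v u ⟨ + 0 , + 0 , - + 3 ⟩ ∷
  pair u u ⟨ + 2 , + 0 , - + 2 ⟩ ∷ pair v u ⟨ + 1 , + 0 , - + 2 ⟩ ∷ pair v v ⟨ + 2 , + 0 , - + 2 ⟩ ∷
  pair u u ⟨ + 1 , - + 1 , - + 2 ⟩ ∷ pair u v ⟨ + 2 , - + 1 , - + 2 ⟩ ∷ pair w̄ w̄ ⟨ + 2 , + 0 , - + 2 ⟩ ∷
  pair u w̄ ⟨ + 0 , + 0 , + 3 ⟩ ∷ pair w ū ⟨ + 0 , + 0 , + 3 ⟩ ∷ pair u ū ⟨ - + 2 , + 0 , + 2 ⟩ ∷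
  pair u v̄ ⟨ - + 1 , + 0 , + 2 ⟩ ∷ pair v ū ⟨ - + 1 , + 0 , + 2 ⟩ ∷ pair v v̄ ⟨ - + 2 , + 0 , + 2 ⟩ ∷
  pair u ū ⟨ - + 1 , - + 1 , + 2 ⟩ ∷ pair w ū ⟨ - + 2 , - + 2 , + 1 ⟩ ∷ pair u w̄ ⟨ - + 2 , - + 2 , + 1 ⟩ ∷
  pair v̄ ū ⟨ - + 1 , - + 1 , + 1 ⟩ ∷ pair v̄ v̄ ⟨ - + 2 , - + 1 , + 1 ⟩ ∷ pair v̄ ū ⟨ - + 2 , - + 2 , + 1 ⟩ ∷
  pair w w̄ ⟨ - + 2 , - + 2 , + 0 ⟩ ∷ pair u ū ⟨ - + 2 , - + 2 , + 0 ⟩ ∷ pair w ū ⟨ - + 2 , - + 2 , - + 1 ⟩ ∷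
  pair ū w ⟨ + 0 , + 0 , - + 3 ⟩ ∷ pair w̄ u ⟨ + 0 , + 0 , - + 3 ⟩ ∷ pair ū u ⟨ + 2 , + 0 , - + 2 ⟩ ∷
  pair ū v ⟨ + 1 , + 0 , - + 2 ⟩ ∷ pair v̄ u ⟨ + 1 , + 0 , - + 2 ⟩ ∷ pair v̄ v ⟨ + 2 , + 0 , - + 2 ⟩ ∷
  pair ū u ⟨ + 1 , + 1 , - + 2 ⟩ ∷ pair w̄ u ⟨ + 2 , + 2 , - + 1 ⟩ ∷ pair ū w ⟨ + 2 , + 2 , - + 1 ⟩ ∷
  pair v u ⟨ + 1 , + 1 , - + 1 ⟩ ∷ pair v v ⟨ + 2 , + 1 , - + 1 ⟩ ∷ pair v u ⟨ + 2 , + 2 , - + 1 ⟩ ∷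
  pair w̄ w ⟨ + 2 , + 2 , + 0 ⟩ ∷ pair ū u ⟨ + 2 , + 2 , + 0 ⟩ ∷ pair w̄ u ⟨ + 2 , + 2 , + 1 ⟩ ∷
  pair u u ⟨ - + 2 , + 0 , + 2 ⟩ ∷ pair u v ⟨ - + 1 , + 0 , + 2 ⟩ ∷ pair v v ⟨ - + 2 , + 0 , + 2 ⟩ ∷
  pair u u ⟨ - + 1 , + 1 , + 2 ⟩ ∷ pair v u ⟨ - + 2 , + 1 , + 2 ⟩ ∷ pair u w ⟨ - + 1 , + 0 , + 2 ⟩ ∷
  pair u v ⟨ + 0 , + 0 , + 3 ⟩ ∷ pair u u ⟨ - + 3 , + 0 , + 1 ⟩ ∷ pair u ū ⟨ - + 1 , + 1 , + 2 ⟩ ∷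
  pair u w ⟨ - + 2 , + 1 , + 2 ⟩ ∷ pair v ū ⟨ - + 2 , + 1 , + 2 ⟩ ∷ pair v w ⟨ - + 3 , + 1 , + 2 ⟩ ∷
  pair v̄ v ⟨ - + 2 , - + 2 , + 0 ⟩ ∷ pair ū u ⟨ - + 3 , - + 1 , + 0 ⟩ ∷ pair v̄ u ⟨ - + 2 , - + 1 , + 0 ⟩ ∷
  pair ū v ⟨ - + 2 , - + 1 , + 0 ⟩ ∷ pair w̄ u ⟨ - + 2 , - + 1 , + 0 ⟩ ∷ pair w̄ v ⟨ - + 1 , - + 1 , + 0 ⟩ ∷
  pair ū u ⟨ - + 2 , + 0 , + 0 ⟩ ∷ pair w̄ u ⟨ - + 1 , + 0 , + 0 ⟩ ∷ pair w̄ w ⟨ + 0 , + 0 , + 0 ⟩ ∷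
  pair ū w ⟨ - + 2 , + 0 , + 1 ⟩ ∷ pair v̄ ū ⟨ + 0 , + 0 , + 1 ⟩ ∷ pair v̄ w ⟨ - + 1 , + 0 , + 1 ⟩ ∷
  pair w̄ u ⟨ + 0 , + 0 , + 1 ⟩ ∷ pair w̄ v ⟨ + 1 , + 0 , + 1 ⟩ ∷ pair ū ū ⟨ + 0 , + 1 , + 1 ⟩ ∷
  pair ū w ⟨ - + 1 , + 1 , + 1 ⟩ ∷ pair w̄ ū ⟨ + 1 , + 1 , + 1 ⟩ ∷ pair w̄ w ⟨ + 0 , + 1 , + 1 ⟩ ∷
  pair ū u ⟨ - + 2 , + 0 , + 2 ⟩ ∷ pair ū v ⟨ - + 1 , + 0 , + 2 ⟩ ∷ pair v̄ u ⟨ - + 1 , + 0 , + 2 ⟩ ∷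
  pair v̄ v ⟨ + 0 , + 0 , + 2 ⟩ ∷ pair ū u ⟨ - + 1 , + 1 , + 2 ⟩ ∷ pair v̄ u ⟨ + 0 , + 1 , + 2 ⟩ ∷
  pair ū v ⟨ + 0 , + 1 , + 2 ⟩ ∷ pair w̄ u ⟨ + 0 , + 1 , + 2 ⟩ ∷ pair w̄ v ⟨ + 1 , + 1 , + 2 ⟩ ∷
  pair ū u ⟨ + 0 , + 2 , + 2 ⟩ ∷ pair w̄ u ⟨ + 1 , + 2 , + 2 ⟩ ∷ pair ū ū ⟨ + 2 , + 0 , - + 2 ⟩ ∷
  pair ū v̄ ⟨ + 1 , + 0 , - + 2 ⟩ ∷ pair v̄ v̄ ⟨ + 2 , + 0 , - + 2 ⟩ ∷ pair ū ū ⟨ + 1 , - + 1 , - + 2 ⟩ ∷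
  pair v̄ ū ⟨ + 2 , - + 1 , - + 2 ⟩ ∷ pair ū w̄ ⟨ + 1 , + 0 , - + 2 ⟩ ∷ pair ū v̄ ⟨ + 0 , + 0 , - + 3 ⟩ ∷
  pair ū ū ⟨ + 3 , + 0 , - + 1 ⟩ ∷ pair ū u ⟨ + 1 , - + 1 , - + 2 ⟩ ∷ pair ū w̄ ⟨ + 2 , - + 1 , - + 2 ⟩ ∷
  pair v̄ u ⟨ + 2 , - + 1 , - + 2 ⟩ ∷ pair v̄ w̄ ⟨ + 3 , - + 1 , - + 2 ⟩ ∷ pair v v̄ ⟨ + 2 , + 2 , + 0 ⟩ ∷
  pair u ū ⟨ + 3 , + 1 , + 0 ⟩ ∷ pair v ū ⟨ + 2 , + 1 , + 0 ⟩ ∷ pair u v̄ ⟨ + 2 , + 1 , + 0 ⟩ ∷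
  pair w ū ⟨ + 2 , + 1 , + 0 ⟩ ∷ pair w v̄ ⟨ + 1 , + 1 , + 0 ⟩ ∷ pair u ū ⟨ + 2 , + 0 , + 0 ⟩ ∷
  pair w ū ⟨ + 1 , + 0 , + 0 ⟩ ∷ pair w w̄ ⟨ + 0 , + 0 , + 0 ⟩ ∷ pair u w̄ ⟨ + 2 , + 0 , - + 1 ⟩ ∷
  pair v u ⟨ + 0 , + 0 , - + 1 ⟩ ∷ pair v w̄ ⟨ + 1 , + 0 , - + 1 ⟩ ∷ pair w ū ⟨ + 0 , + 0 , - + 1 ⟩ ∷
  pair w v̄ ⟨ - + 1 , + 0 , - + 1 ⟩ ∷ pair u u ⟨ + 0 , - + 1 , - + 1 ⟩ ∷ pair u w̄ ⟨ + 1 , - + 1 , - + 1 ⟩ ∷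
  pair w u ⟨ - + 1 , - + 1 , - + 1 ⟩ ∷ pair w w̄ ⟨ + 0 , - + 1 , - + 1 ⟩ ∷ pair u ū ⟨ + 2 , + 0 , - + 2 ⟩ ∷
  pair u v̄ ⟨ + 1 , + 0 , - + 2 ⟩ ∷ pair v ū ⟨ + 1 , + 0 , - + 2 ⟩ ∷ pair v v̄ ⟨ + 0 , + 0 , - + 2 ⟩ ∷
  pair u ū ⟨ + 1 , - + 1 , - + 2 ⟩ ∷ pair v ū ⟨ + 0 , - + 1 , - + 2 ⟩ ∷ pair u v̄ ⟨ + 0 , - + 1 , - + 2 ⟩ ∷
  pair w ū ⟨ + 0 , - + 1 , - + 2 ⟩ ∷ pair w v̄ ⟨ - + 1 , - + 1 , - + 2 ⟩ ∷ pair u ū ⟨ + 0 , - + 2 , - + 2 ⟩ ∷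
  pair w ū ⟨ - + 1 , - + 2 , - + 2 ⟩ ∷ pair w̄ ū ⟨ - + 2 , - + 1 , + 0 ⟩ ∷ pair w̄ v̄ ⟨ - + 3 , - + 1 , + 0 ⟩ ∷
  pair w u ⟨ + 2 , + 1 , + 0 ⟩ ∷ pair w v ⟨ + 3 , + 1 , + 0 ⟩ ∷ pair ū v ⟨ - + 2 , - + 2 , - + 1 ⟩ ∷
  pair w̄ u ⟨ - + 2 , - + 2 , - + 1 ⟩ ∷ pair w̄ v ⟨ - + 1 , - + 2 , - + 1 ⟩ ∷ pair ū w ⟨ - + 2 , - + 2 , - + 1 ⟩ ∷
  pair v̄ w ⟨ - + 1 , - + 2 , - + 1 ⟩ ∷ pair u v ⟨ - + 2 , - + 2 , - + 1 ⟩ ∷ pair u u ⟨ - + 2 , - + 1 , - + 1 ⟩ ∷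
  pair u w ⟨ - + 1 , - + 1 , - + 1 ⟩ ∷ pair w̄ u ⟨ - + 3 , - + 1 , - + 1 ⟩ ∷ pair ū u ⟨ - + 2 , - + 2 , + 0 ⟩ ∷
  pair ū v ⟨ - + 1 , - + 2 , + 0 ⟩ ∷ pair v̄ u ⟨ - + 1 , - + 2 , + 0 ⟩ ∷ pair v̄ v ⟨ + 0 , - + 2 , + 0 ⟩ ∷
  pair u u ⟨ - + 1 , - + 1 , + 0 ⟩ ∷ pair u v ⟨ + 0 , - + 1 , + 0 ⟩ ∷ pair u ū ⟨ + 0 , + 0 , + 0 ⟩ ∷
  pair u w ⟨ - + 1 , + 0 , + 0 ⟩ ∷ pair w̄ ū ⟨ - + 1 , + 0 , + 0 ⟩ ∷ pair w̄ w ⟨ - + 2 , + 0 , + 0 ⟩ ∷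
  pair w̄ ū ⟨ + 0 , + 0 , + 1 ⟩ ∷ pair w̄ v̄ ⟨ - + 1 , + 0 , + 1 ⟩ ∷ pair w̄ ū ⟨ - + 1 , - + 1 , + 1 ⟩ ∷
  pair w̄ w ⟨ - + 2 , - + 1 , + 1 ⟩ ∷ pair u u ⟨ - + 1 , + 0 , + 1 ⟩ ∷ pair u v ⟨ + 0 , + 0 , + 1 ⟩ ∷
  pair w̄ u ⟨ - + 2 , + 0 , + 1 ⟩ ∷ pair w̄ v ⟨ - + 1 , + 0 , + 1 ⟩ ∷ pair w̄ u ⟨ - + 1 , + 1 , + 1 ⟩ ∷
  pair ū v̄ ⟨ - + 1 , + 0 , + 2 ⟩ ∷ pair v̄ ū ⟨ + 1 , + 0 , + 2 ⟩ ∷ pair v̄ v̄ ⟨ + 0 , + 0 , + 2 ⟩ ∷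
  pair ū ū ⟨ - + 1 , - + 1 , + 2 ⟩ ∷ pair v̄ ū ⟨ + 0 , - + 1 , + 2 ⟩ ∷ pair v̄ w ⟨ - + 1 , - + 1 , + 2 ⟩ ∷
  pair w̄ ū ⟨ + 0 , + 1 , + 2 ⟩ ∷ pair w̄ v̄ ⟨ - + 1 , + 1 , + 2 ⟩ ∷ pair w̄ ū ⟨ - + 1 , + 0 , + 2 ⟩ ∷
  pair w̄ w ⟨ - + 2 , + 0 , + 2 ⟩ ∷ pair w̄ v ⟨ - + 1 , - + 1 , + 2 ⟩ ∷ pair w̄ u ⟨ - + 1 , + 0 , + 2 ⟩ ∷
  pair w̄ w ⟨ + 0 , + 0 , + 2 ⟩ ∷ pair v̄ v ⟨ + 0 , - + 1 , + 3 ⟩ ∷ pair w̄ u ⟨ + 0 , + 0 , + 3 ⟩ ∷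
  pair w̄ v ⟨ + 1 , + 0 , + 3 ⟩ ∷ pair ū w ⟨ + 0 , + 0 , + 3 ⟩ ∷ pair v̄ u ⟨ + 0 , + 0 , + 3 ⟩ ∷
  pair v̄ w ⟨ + 1 , + 0 , + 3 ⟩ ∷ pair v̄ v ⟨ + 2 , + 0 , + 4 ⟩ ∷ pair u v̄ ⟨ + 2 , + 2 , + 1 ⟩ ∷
  pair w ū ⟨ + 2 , + 2 , + 1 ⟩ ∷ pair w v̄ ⟨ + 1 , + 2 , + 1 ⟩ ∷ pair u w̄ ⟨ + 2 , + 2 , + 1 ⟩ ∷
  pair v w̄ ⟨ + 1 , + 2 , + 1 ⟩ ∷ pair ū v̄ ⟨ + 2 , + 2 , + 1 ⟩ ∷ pair ū ū ⟨ + 2 , + 1 , + 1 ⟩ ∷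
  pair ū w̄ ⟨ + 1 , + 1 , + 1 ⟩ ∷ pair w ū ⟨ + 3 , + 1 , + 1 ⟩ ∷ pair u ū ⟨ + 2 , + 2 , + 0 ⟩ ∷
  pair u v̄ ⟨ + 1 , + 2 , + 0 ⟩ ∷ pair v ū ⟨ + 1 , + 2 , + 0 ⟩ ∷ pair v v̄ ⟨ + 0 , + 2 , + 0 ⟩ ∷
  pair ū ū ⟨ + 1 , + 1 , + 0 ⟩ ∷ pair ū v̄ ⟨ + 0 , + 1 , + 0 ⟩ ∷ pair ū u ⟨ + 0 , + 0 , + 0 ⟩ ∷
  pair ū w̄ ⟨ + 1 , + 0 , + 0 ⟩ ∷ pair w u ⟨ + 1 , + 0 , + 0 ⟩ ∷ pair w w̄ ⟨ + 2 , + 0 , + 0 ⟩ ∷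
  pair w u ⟨ + 0 , + 0 , - + 1 ⟩ ∷ pair w v ⟨ + 1 , + 0 , - + 1 ⟩ ∷ pair w u ⟨ + 1 , + 1 , - + 1 ⟩ ∷
  pair w w̄ ⟨ + 2 , + 1 , - + 1 ⟩ ∷ pair ū ū ⟨ + 1 , + 0 , - + 1 ⟩ ∷ pair ū v̄ ⟨ + 0 , + 0 , - + 1 ⟩ ∷
  pair w ū ⟨ + 2 , + 0 , - + 1 ⟩ ∷ pair w v̄ ⟨ + 1 , + 0 , - + 1 ⟩ ∷ pair w ū ⟨ + 1 , - + 1 , - + 1 ⟩ ∷
  pair u v ⟨ + 1 , + 0 , - + 2 ⟩ ∷ pair v u ⟨ - + 1 , + 0 , - + 2 ⟩ ∷ pair v v ⟨ + 0 , + 0 , - + 2 ⟩ ∷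
  pair u u ⟨ + 1 , + 1 , - + 2 ⟩ ∷ pair v u ⟨ + 0 , + 1 , - + 2 ⟩ ∷ pair v w̄ ⟨ + 1 , + 1 , - + 2 ⟩ ∷
  pair w u ⟨ + 0 , - + 1 , - + 2 ⟩ ∷ pair w v ⟨ + 1 , - + 1 , - + 2 ⟩ ∷ pair w u ⟨ + 1 , + 0 , - + 2 ⟩ ∷
  pair w w̄ ⟨ + 2 , + 0 , - + 2 ⟩ ∷ pair w v̄ ⟨ + 1 , + 1 , - + 2 ⟩ ∷ pair w ū ⟨ + 1 , + 0 , - + 2 ⟩ ∷
  pair w w̄ ⟨ + 0 , + 0 , - + 2 ⟩ ∷ pair v v̄ ⟨ + 0 , + 1 , - + 3 ⟩ ∷ pair w ū ⟨ + 0 , + 0 , - + 3 ⟩ ∷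
  pair w v̄ ⟨ - + 1 , + 0 , - + 3 ⟩ ∷ pair u w̄ ⟨ + 0 , + 0 , - + 3 ⟩ ∷ pair v ū ⟨ + 0 , + 0 , - + 3 ⟩ ∷
  pair v w̄ ⟨ - + 1 , + 0 , - + 3 ⟩ ∷ pair v v̄ ⟨ - + 2 , + 0 , - + 4 ⟩ ∷ pair u v ⟨ - + 1 , - + 2 , - + 2 ⟩ ∷
  pair u w ⟨ - + 2 , - + 1 , - + 2 ⟩ ∷ pair v ū ⟨ - + 2 , - + 1 , - + 2 ⟩ ∷ pair v w ⟨ - + 3 , - + 1 , - + 2 ⟩ ∷
  pair ū u ⟨ - + 3 , - + 1 , - + 2 ⟩ ∷ pair ū w ⟨ - + 2 , - + 1 , - + 2 ⟩ ∷ pair v̄ u ⟨ - + 2 , - + 1 , - + 2 ⟩ ∷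
  pair v̄ w ⟨ - + 1 , - + 1 , - + 2 ⟩ ∷ pair ū v ⟨ - + 2 , - + 1 , - + 2 ⟩ ∷ pair ū u ⟨ - + 2 , + 0 , - + 2 ⟩ ∷
  pair ū w ⟨ - + 1 , + 0 , - + 2 ⟩ ∷ pair w̄ w ⟨ + 0 , + 0 , - + 2 ⟩ ∷ pair u v ⟨ - + 1 , - + 1 , - + 1 ⟩ ∷
  pair v u ⟨ - + 3 , - + 1 , - + 1 ⟩ ∷ pair v v ⟨ - + 2 , - + 1 , - + 1 ⟩ ∷ pair u u ⟨ - + 1 , + 0 , - + 1 ⟩ ∷
  pair u w ⟨ + 0 , + 0 , - + 1 ⟩ ∷ pair v u ⟨ - + 2 , + 0 , - + 1 ⟩ ∷ pair v w ⟨ - + 1 , + 0 , - + 1 ⟩ ∷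
  pair u v̄ ⟨ - + 1 , + 0 , + 0 ⟩ ∷ pair v ū ⟨ - + 1 , + 0 , + 0 ⟩ ∷ pair v v̄ ⟨ - + 2 , + 0 , + 0 ⟩ ∷
  pair u ū ⟨ - + 1 , - + 1 , + 0 ⟩ ∷ pair u w ⟨ - + 2 , - + 1 , + 0 ⟩ ∷ pair v ū ⟨ - + 2 , - + 1 , + 0 ⟩ ∷
  pair v w ⟨ - + 3 , - + 1 , + 0 ⟩ ∷ pair u v̄ ⟨ - + 2 , - + 1 , + 0 ⟩ ∷ pair w̄ ū ⟨ - + 2 , + 0 , + 1 ⟩ ∷
  pair w̄ v̄ ⟨ - + 3 , + 0 , + 1 ⟩ ∷ pair u u ⟨ - + 2 , - + 1 , + 1 ⟩ ∷ pair u v ⟨ - + 1 , - + 1 , + 1 ⟩ ∷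
  pair v v ⟨ - + 2 , - + 1 , + 1 ⟩ ∷ pair v u ⟨ - + 2 , + 0 , + 1 ⟩ ∷ pair u v ⟨ - + 2 , - + 2 , + 1 ⟩ ∷
  pair w̄ w̄ ⟨ - + 2 , + 0 , + 2 ⟩ ∷ pair ū ū ⟨ - + 3 , + 0 , + 1 ⟩ ∷ pair ū v̄ ⟨ + 1 , + 2 , + 2 ⟩ ∷
  pair ū w̄ ⟨ + 2 , + 1 , + 2 ⟩ ∷ pair v̄ u ⟨ + 2 , + 1 , + 2 ⟩ ∷ pair v̄ w̄ ⟨ + 3 , + 1 , + 2 ⟩ ∷
  pair u ū ⟨ + 3 , + 1 , + 2 ⟩ ∷ pair u w̄ ⟨ + 2 , + 1 , + 2 ⟩ ∷ pair v ū ⟨ + 2 , + 1 , + 2 ⟩ ∷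
  pair v w̄ ⟨ + 1 , + 1 , + 2 ⟩ ∷ pair u v̄ ⟨ + 2 , + 1 , + 2 ⟩ ∷ pair u ū ⟨ + 2 , + 0 , + 2 ⟩ ∷
  pair u w̄ ⟨ + 1 , + 0 , + 2 ⟩ ∷ pair w w̄ ⟨ + 0 , + 0 , + 2 ⟩ ∷ pair ū v̄ ⟨ + 1 , + 1 , + 1 ⟩ ∷
  pair v̄ ū ⟨ + 3 , + 1 , + 1 ⟩ ∷ pair v̄ v̄ ⟨ + 2 , + 1 , + 1 ⟩ ∷ pair ū ū ⟨ + 1 , + 0 , + 1 ⟩ ∷
  pair ū w̄ ⟨ + 0 , + 0 , + 1 ⟩ ∷ pair v̄ ū ⟨ + 2 , + 0 , + 1 ⟩ ∷ pair v̄ w̄ ⟨ + 1 , + 0 , + 1 ⟩ ∷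
  pair ū v ⟨ + 1 , + 0 , + 0 ⟩ ∷ pair v̄ u ⟨ + 1 , + 0 , + 0 ⟩ ∷ pair v̄ v ⟨ + 2 , + 0 , + 0 ⟩ ∷
  pair ū u ⟨ + 1 , + 1 , + 0 ⟩ ∷ pair ū w̄ ⟨ + 2 , + 1 , + 0 ⟩ ∷ pair v̄ u ⟨ + 2 , + 1 , + 0 ⟩ ∷
  pair v̄ w̄ ⟨ + 3 , + 1 , + 0 ⟩ ∷ pair ū v ⟨ + 2 , + 1 , + 0 ⟩ ∷ pair w u ⟨ + 2 , + 0 , - + 1 ⟩ ∷
  pair w v ⟨ + 3 , + 0 , - + 1 ⟩ ∷ pair ū ū ⟨ + 2 , + 1 , - + 1 ⟩ ∷ pair ū v̄ ⟨ + 1 , + 1 , - + 1 ⟩ ∷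
  pair v̄ v̄ ⟨ + 2 , + 1 , - + 1 ⟩ ∷ pair v̄ ū ⟨ + 2 , + 0 , - + 1 ⟩ ∷ pair ū v̄ ⟨ + 2 , + 2 , - + 1 ⟩ ∷
  pair w w ⟨ + 2 , + 0 , - + 2 ⟩ ∷ pair u u ⟨ + 3 , + 0 , - + 1 ⟩ ∷ pair ū u ⟨ + 0 , - + 2 , - + 2 ⟩ ∷
  pair ū v ⟨ + 1 , - + 2 , - + 2 ⟩ ∷ pair v̄ u ⟨ + 1 , - + 2 , - + 2 ⟩ ∷ pair v̄ v ⟨ + 2 , - + 2 , - + 2 ⟩ ∷
  pair u w ⟨ + 1 , + 0 , - + 2 ⟩ ∷ pair u w ⟨ + 0 , - + 1 , - + 2 ⟩ ∷ pair v w ⟨ - + 1 , - + 1 , - + 2 ⟩ ∷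
  pair u w ⟨ - + 1 , - + 2 , - + 2 ⟩ ∷ pair u v ⟨ + 1 , - + 1 , - + 1 ⟩ ∷ pair v u ⟨ - + 1 , - + 1 , - + 1 ⟩ ∷
  pair v v ⟨ + 0 , - + 1 , - + 1 ⟩ ∷ pair u u ⟨ - + 1 , - + 2 , - + 1 ⟩ ∷ pair u v ⟨ + 0 , - + 2 , - + 1 ⟩ ∷
  pair w u ⟨ - + 2 , - + 2 , - + 1 ⟩ ∷ pair w v ⟨ - + 1 , - + 2 , - + 1 ⟩ ∷ pair w ū ⟨ - + 1 , - + 1 , - + 1 ⟩ ∷
  pair w w ⟨ - + 2 , - + 1 , - + 1 ⟩ ∷ pair u w̄ ⟨ - + 2 , - + 1 , + 0 ⟩ ∷ pair v w̄ ⟨ - + 3 , - + 1 , + 0 ⟩ ∷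
  pair u ū ⟨ - + 2 , - + 1 , - + 1 ⟩ ∷ pair u v̄ ⟨ - + 3 , - + 1 , - + 1 ⟩ ∷ pair v ū ⟨ - + 3 , - + 1 , - + 1 ⟩ ∷
  pair u u ⟨ - + 3 , - + 1 , + 0 ⟩ ∷ pair u ū ⟨ + 0 , + 2 , + 2 ⟩ ∷ pair u v̄ ⟨ - + 1 , + 2 , + 2 ⟩ ∷
  pair v ū ⟨ - + 1 , + 2 , + 2 ⟩ ∷ pair v v̄ ⟨ - + 2 , + 2 , + 2 ⟩ ∷ pair ū w̄ ⟨ - + 1 , + 0 , + 2 ⟩ ∷
  pair ū w̄ ⟨ + 0 , + 1 , + 2 ⟩ ∷ pair v̄ w̄ ⟨ + 1 , + 1 , + 2 ⟩ ∷ pair ū w̄ ⟨ + 1 , + 2 , + 2 ⟩ ∷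
  pair ū v̄ ⟨ - + 1 , + 1 , + 1 ⟩ ∷ pair v̄ ū ⟨ + 1 , + 1 , + 1 ⟩ ∷ pair v̄ v̄ ⟨ + 0 , + 1 , + 1 ⟩ ∷
  pair ū ū ⟨ + 1 , + 2 , + 1 ⟩ ∷ pair ū v̄ ⟨ + 0 , + 2 , + 1 ⟩ ∷ pair w̄ ū ⟨ + 2 , + 2 , + 1 ⟩ ∷
  pair w̄ v̄ ⟨ + 1 , + 2 , + 1 ⟩ ∷ pair w̄ u ⟨ + 1 , + 1 , + 1 ⟩ ∷ pair w̄ w̄ ⟨ + 2 , + 1 , + 1 ⟩ ∷
  pair ū w ⟨ + 2 , + 1 , + 0 ⟩ ∷ pair v̄ w ⟨ + 3 , + 1 , + 0 ⟩ ∷ pair ū u ⟨ + 2 , + 1 , + 1 ⟩ ∷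
  pair ū v ⟨ + 3 , + 1 , + 1 ⟩ ∷ pair v̄ u ⟨ + 3 , + 1 , + 1 ⟩ ∷ pair ū ū ⟨ + 3 , + 1 , + 0 ⟩ ∷
  pair v w ⟨ + 1 , + 1 , - + 2 ⟩ ∷ pair u w ⟨ + 0 , + 0 , - + 3 ⟩ ∷ pair v w ⟨ - + 1 , + 0 , - + 3 ⟩ ∷
  pair w u ⟨ - + 2 , - + 1 , - + 2 ⟩ ∷ pair w v ⟨ - + 1 , - + 1 , - + 2 ⟩ ∷ pair w u ⟨ - + 1 , + 0 , - + 2 ⟩ ∷
  pair w w ⟨ + 0 , + 0 , - + 2 ⟩ ∷ pair u u ⟨ - + 1 , + 0 , - + 3 ⟩ ∷ pair v u ⟨ - + 2 , + 0 , - + 3 ⟩ ∷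
  pair u w̄ ⟨ - + 2 , - + 2 , - + 1 ⟩ ∷ pair v̄ w̄ ⟨ - + 1 , - + 1 , + 2 ⟩ ∷ pair ū w̄ ⟨ + 0 , + 0 , + 3 ⟩ ∷
  pair v̄ w̄ ⟨ + 1 , + 0 , + 3 ⟩ ∷ pair w̄ ū ⟨ + 2 , + 1 , + 2 ⟩ ∷ pair w̄ v̄ ⟨ + 1 , + 1 , + 2 ⟩ ∷
  pair w̄ ū ⟨ + 1 , + 0 , + 2 ⟩ ∷ pair w̄ w̄ ⟨ + 0 , + 0 , + 2 ⟩ ∷ pair ū ū ⟨ + 1 , + 0 , + 3 ⟩ ∷
  pair v̄ ū ⟨ + 2 , + 0 , + 3 ⟩ ∷ pair ū w ⟨ + 2 , + 2 , + 1 ⟩ ∷ pair w w ⟨ + 2 , + 1 , - + 1 ⟩ ∷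
  pair ū v ⟨ + 2 , - + 1 , - + 2 ⟩ ∷ pair w u ⟨ + 2 , - + 1 , - + 2 ⟩ ∷ pair w v ⟨ + 3 , - + 1 , - + 2 ⟩ ∷
  pair w̄ w̄ ⟨ - + 2 , - + 1 , + 1 ⟩ ∷ pair u v̄ ⟨ - + 2 , + 1 , + 2 ⟩ ∷ pair w̄ ū ⟨ - + 2 , + 1 , + 2 ⟩ ∷
  pair w̄ v̄ ⟨ - + 3 , + 1 , + 2 ⟩ ∷
  []

start∈nearPairs : ∀ x → start x ∈ nearPairs
start∈nearPairs u = here refl
start∈nearPairs ū = there (here refl)
start∈nearPairs v = there (there (here refl))
start∈nearPairs v̄ = there (there (there (here refl)))
start∈nearPairs w = there (there (there (there (here refl))))
start∈nearPairs w̄ = there (there (there (there (there (here refl)))))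

Tracked : Pair → Set
Tracked s = Far (Pair.offset s) ⊎ s ∈ nearPairs

tracked? : ∀ s → Dec (Tracked s)
tracked? s = far? (Pair.offset s) ⊎-dec s ∈? nearPairs

nearPairs-successors : All (All Tracked ∘ successors) nearPairs
nearPairs-successors = allYes⇒All (λ s → all? tracked? (successors s)) nearPairs _

nearPairs-separated : All Separated nearPairs
nearPairs-separated = allYes⇒All separated? nearPairs _

σ²≤1 : ∀ x → σ x ² ≤ + 1
σ²≤1 u = ℤ.≤-refl
σ²≤1 ū = ℤ.≤-refl
σ²≤1 v = ℤ.≤-refl
σ²≤1 v̄ = ℤ.≤-refl
σ²≤1 w = ℤ.≤-refl
σ²≤1 w̄ = ℤ.≤-refl

far-successors : ∀ x y h → Far h → All (Far ∘ Pair.offset) (successors (pair x y h))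
far-successors x y h far =
  far-step (+ 0) (+ 0) h 0²≤1 0²≤1 far ∷ far-step (+ 0) (σ y) h 0²≤1 (σ²≤1 y) far ∷
  far-step (σ x) (+ 0) h (σ²≤1 x) 0²≤1 far ∷ far-step (σ x) (σ y) h (σ²≤1 x) (σ²≤1 y) far ∷ []
  where
  0²≤1 : (+ 0) ² ≤ + 1
  0²≤1 = +≤+ ℕ.z≤n

tracked-successors : ∀ {s} → Tracked s → All Tracked (successors s)
tracked-successors {pair x y h} (inj₁ far) = All.map inj₁ (far-successors x y h far)
tracked-successors (inj₂ s∈near)           = All.lookup nearPairs-successors s∈near

tracked-separated : ∀ {s} → Tracked s → Separated s
tracked-separated {pair x y h} (inj₁ far) (πh≡0 , _) = far⇒π≢0ₚ h far πh≡0
tracked-separated (inj₂ s∈near)                      = All.lookup nearPairs-separated s∈near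

tracked⇒apart : ∀ m s → Tracked s → Apart m s
tracked⇒apart zero    s tracked = apart-zero s (tracked-separated tracked)
tracked⇒apart (suc m) s tracked =
  apart-suc m s (All.map (λ {t} → tracked⇒apart m t) (tracked-successors tracked))

curve-unique : ∀ m x p → Unique (curve m x p)
curve-unique zero    x p = [] ∷ []
curve-unique (suc m) x p rewrite curve-suc m x p =
  ++⁺ (curve-unique m (first x) p) (curve-unique m (second x) _)
      (tracked⇒apart m (start x) (inj₂ (start∈nearPairs x)) p)

lemma5 : (n : ℕ) → SelfAvoiding (C n)
lemma5 n = curve-unique n u 0ₚ
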